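{- Let $q \geq 5$ be an odd prime power and let $a \in F_q$ be such that $a^2+1$ is not a square in $F_q$. Then there exists $t \in F_q^{\ast}$ such that for every $i \in F_q$, if $A$ lies on the line $y = ax + i$ and $B$ lies on the line $y = ax + i + t$ (in $F_q^2$), then $Q(A,B) \neq 1$.
   Context: $F_q$ is the finite field with $q$ elements, $F_q^\ast = F_q\setminus\{0\}$. For $A_1 = (x_1,y_1)$, $A_2 = (x_2,y_2) \in F_q^2$, the quadrance is $Q(A_1,A_2) = (x_2-x_1)^2 + (y_2-y_1)^2$. -}

module Defs where

open import Level using (Level; _⊔_)
open import Data.Nat using (ℕ; _^_; _≤_; suc)
open import Data.Nat.Primality using (Prime)
open import Data.Nat.Divisibility using (_∣_)
open import Data.Fin using (Fin)
open import Data.Product using (Σ; ∃; _×_)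
open import Relation.Nullary using (¬_)
open import Relation.Binary.PropositionalEquality using (_≡_)
open import Algebra.Bundles using (CommutativeRing)

IsPrimePower : ℕ → Set
IsPrimePower q = Σ ℕ λ p → Σ ℕ λ k → Prime p × 1 ≤ k × q ≡ p ^ k

module _ {c ℓ : Level} (R : CommutativeRing c ℓ) where
  open CommutativeRing R

  record IsFiniteField (q : ℕ) : Set (c ⊔ ℓ) where
    field
      0≉1     : ¬ (0# ≈ 1#)
      inverse : ∀ x → ¬ (x ≈ 0#) → ∃ λ y → x * y ≈ 1#
      enum    : Fin q → Carrier
      enum-injective  : ∀ i j → enum i ≈ enum j → i ≡ j
      enum-surjective : ∀ x → ∃ λ i → enum i ≈ x

  IsSquare : Carrier → Set (c ⊔ ℓ)
  IsSquare x = ∃ λ y → y * y ≈ x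

  Quadrance : Carrier × Carrier → Carrier × Carrier → Carrier
  Quadrance (x₁ Data.Product., y₁) (x₂ Data.Product., y₂) =
    (x₂ - x₁) * (x₂ - x₁) + (y₂ - y₁) * (y₂ - y₁)

-- Write k = a² + 1. For A on y = ax + i and B on y = ax + i + t, put u = x_B − x_A;
-- then Q(A,B) = u² + (au + t)² and (ku + at)² = k·Q(A,B) − t². Hence Q(A,B) = 1
-- makes k − t² a square. Take t from a point (t, m) with m ≠ 0 on the conic
-- t² + km² = k, given by the rational parametrisation t = 2kl/(1 + kl²),
-- m = (1 − kl²)/(1 + kl²): then k − t² = km² is a non-square since k is.
-- A parameter l exists as soon as the field has an element outside {0, 1, −1}.
module Submission where

open import Defs
open import Level using (Level)
open import Data.Nat as ℕ using (ℕ; zero; suc; _≤_)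
open import Data.Nat.Properties using (<⇒≤)
open import Data.Nat.Divisibility using (_∣_)
open import Data.Fin using (Fin; zero; suc)
open import Data.Fin.Properties using (any?; all?; ¬∀⟶∃¬; pigeonhole; <⇒≢)
  renaming (_≟_ to _≟ᶠ_)
open import Data.Product using (_×_; _,_; ∃; ∃₂; proj₁; proj₂)
open import Data.Product.Properties using (≡-dec)
open import Data.Sum using (_⊎_; inj₁; inj₂; [_,_]′)
import Data.Sum as Sum
open import Data.Vec using ([]; _∷_; lookup)
import Data.Maybe as Maybe
open import Function using (_∘_)
open import Relation.Nullary using (¬_; yes; no)
open import Relation.Nullary.Decidable using (¬?; decidable-stable)
open import Relation.Nullary.Decidable.Core using (dec⇒maybe)
open import Relation.Binary.Bundles using (Setoid)
open import Relation.Binary.Definitions using (Decidable)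
open import Relation.Binary.PropositionalEquality as ≡ using (_≡_)
open import Algebra.Bundles using (CommutativeRing; RawRing)
open import Algebra.Solver.Ring.AlmostCommutativeRing
  using (_-Raw-AlmostCommutative⟶_; fromCommutativeRing)

module IntegerCoefficientSolver {c ℓ} (R : CommutativeRing c ℓ) where
  open CommutativeRing R
  open import Algebra.Properties.Semiring.Mult.TCOptimised semiring
    using (1+×; ×-homo-+; ×1-homo-*) renaming (_×_ to _·_)
  open import Algebra.Properties.AbelianGroup +-abelianGroup
    using (⁻¹-∙-comm; ⁻¹-anti-homo‿-)
  open import Algebra.Properties.CommutativeSemigroup +-commutativeSemigroup
    using (interchange)
  open import Algebra.Properties.Ring ring using (-0#≈0#; [y-z]x≈yx-zx; x[y-z]≈xy-xz)
  open import Relation.Binary.Reasoning.Setoid setoid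

  ℤ-rawRing : RawRing _ _
  ℤ-rawRing = record
    { Carrier = ℕ × ℕ
    ; _≈_     = _≡_
    ; _+_     = λ { (m , n) (m′ , n′) → m ℕ.+ m′ , n ℕ.+ n′ }
    ; _*_     = λ { (m , n) (m′ , n′) → m ℕ.* m′ ℕ.+ n ℕ.* n′ , m ℕ.* n′ ℕ.+ n ℕ.* m′ }
    ; -_      = λ { (m , n) → n , m }
    ; 0#      = 0 , 0
    ; 1#      = 1 , 0
    }

  cancel : ℕ × ℕ → ℕ × ℕ
  cancel (suc m , suc n) = cancel (m , n)
  cancel x               = x

  -- (m , n) denotes m − n. Cancelling common successors first makes every numeral
  -- denote the expected closed term (1 ↦ 1#, 2 ↦ 1# + 1#), so the solver's
  -- constants con (1 , 0) and con (2 , 0) match the literals 1# and 1# + 1# in goals.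
  ⟦_⟧ℤ : ℕ × ℕ → Carrier
  ⟦ m     , zero  ⟧ℤ = m · 1#
  ⟦ zero  , suc n ⟧ℤ = - (suc n · 1#)
  ⟦ suc m , suc n ⟧ℤ = ⟦ m , n ⟧ℤ

  ⟦cancel⟧ : ∀ x → ⟦ cancel x ⟧ℤ ≡ ⟦ x ⟧ℤ
  ⟦cancel⟧ (suc m , suc n) = ⟦cancel⟧ (m , n)
  ⟦cancel⟧ (zero  , _)     = ≡.refl
  ⟦cancel⟧ (suc m , zero)  = ≡.refl

  -‿interchange : ∀ w x y z → (w + x) - (y + z) ≈ (w - y) + (x - z)
  -‿interchange w x y z = begin
    (w + x) - (y + z)     ≈⟨ +-congˡ (⁻¹-∙-comm y z) ⟨
    (w + x) + (- y + - z) ≈⟨ interchange w x (- y) (- z) ⟩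
    (w - y) + (x - z)     ∎

  ⟦⟧-difference : ∀ m n → ⟦ m , n ⟧ℤ ≈ m · 1# - n · 1#
  ⟦⟧-difference m       zero    = sym (trans (+-congˡ -0#≈0#) (+-identityʳ _))
  ⟦⟧-difference zero    (suc n) = sym (+-identityˡ _)
  ⟦⟧-difference (suc m) (suc n) = begin
    ⟦ m , n ⟧ℤ                        ≈⟨ ⟦⟧-difference m n ⟩
    m · 1# - n · 1#                   ≈⟨ +-identityˡ _ ⟨
    0# + (m · 1# - n · 1#)            ≈⟨ +-congʳ (-‿inverseʳ 1#) ⟨
    (1# - 1#) + (m · 1# - n · 1#)     ≈⟨ -‿interchange 1# (m · 1#) 1# (n · 1#) ⟨
    (1# + m · 1#) - (1# + n · 1#)     ≈⟨ +-cong (1+× m 1#) (-‿cong (1+× n 1#)) ⟨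
    suc m · 1# - suc n · 1#           ∎

  *-difference : ∀ w x y z → (w * y + x * z) - (w * z + x * y) ≈ (w - x) * (y - z)
  *-difference w x y z = begin
    (w * y + x * z) - (w * z + x * y)   ≈⟨ +-congˡ (-‿cong (+-comm (w * z) (x * y))) ⟩
    (w * y + x * z) - (x * y + w * z)   ≈⟨ -‿interchange (w * y) (x * z) (x * y) (w * z) ⟩
    (w * y - x * y) + (x * z - w * z)   ≈⟨ +-congˡ (⁻¹-anti-homo‿- (w * z) (x * z)) ⟨
    (w * y - x * y) - (w * z - x * z)   ≈⟨ +-cong ([y-z]x≈yx-zx y w x) (-‿cong ([y-z]x≈yx-zx z w x)) ⟨
    (w - x) * y - (w - x) * z           ≈⟨ x[y-z]≈xy-xz (w - x) y z ⟨
    (w - x) * (y - z)                   ∎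

  embedding : ℤ-rawRing -Raw-AlmostCommutative⟶ fromCommutativeRing R
  embedding = record
    { ⟦_⟧    = ⟦_⟧ℤ
    ; +-homo = λ { (m , n) (m′ , n′) → begin
        ⟦ m ℕ.+ m′ , n ℕ.+ n′ ⟧ℤ                  ≈⟨ ⟦⟧-difference (m ℕ.+ m′) (n ℕ.+ n′) ⟩
        (m ℕ.+ m′) · 1# - (n ℕ.+ n′) · 1#       ≈⟨ +-cong (×-homo-+ 1# m m′) (-‿cong (×-homo-+ 1# n n′)) ⟩
        (m · 1# + m′ · 1#) - (n · 1# + n′ · 1#) ≈⟨ -‿interchange (m · 1#) (m′ · 1#) (n · 1#) (n′ · 1#) ⟩
        (m · 1# - n · 1#) + (m′ · 1# - n′ · 1#) ≈⟨ +-cong (⟦⟧-difference m n) (⟦⟧-difference m′ n′) ⟨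
        ⟦ m , n ⟧ℤ + ⟦ m′ , n′ ⟧ℤ                 ∎ }
    ; *-homo = λ { (m , n) (m′ , n′) → begin
        ⟦ m ℕ.* m′ ℕ.+ n ℕ.* n′ , m ℕ.* n′ ℕ.+ n ℕ.* m′ ⟧ℤ
          ≈⟨ ⟦⟧-difference (m ℕ.* m′ ℕ.+ n ℕ.* n′) (m ℕ.* n′ ℕ.+ n ℕ.* m′) ⟩
        (m ℕ.* m′ ℕ.+ n ℕ.* n′) · 1# - (m ℕ.* n′ ℕ.+ n ℕ.* m′) · 1#
          ≈⟨ +-cong (·-homo-sum m m′ n n′) (-‿cong (·-homo-sum m n′ n m′)) ⟩
        (m · 1# * m′ · 1# + n · 1# * n′ · 1#) - (m · 1# * n′ · 1# + n · 1# * m′ · 1#)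
          ≈⟨ *-difference (m · 1#) (n · 1#) (m′ · 1#) (n′ · 1#) ⟩
        (m · 1# - n · 1#) * (m′ · 1# - n′ · 1#)
          ≈⟨ *-cong (⟦⟧-difference m n) (⟦⟧-difference m′ n′) ⟨
        ⟦ m , n ⟧ℤ * ⟦ m′ , n′ ⟧ℤ
          ∎ }
    ; -‿homo = λ { (m , n) → begin
        ⟦ n , m ⟧ℤ         ≈⟨ ⟦⟧-difference n m ⟩
        n · 1# - m · 1#    ≈⟨ ⁻¹-anti-homo‿- (m · 1#) (n · 1#) ⟨
        - (m · 1# - n · 1#) ≈⟨ -‿cong (⟦⟧-difference m n) ⟨
        - ⟦ m , n ⟧ℤ        ∎ }
    ; 0-homo = refl
    ; 1-homo = refl
    }
    where
    ·-homo-sum : ∀ w x y z → (w ℕ.* x ℕ.+ y ℕ.* z) · 1# ≈ w · 1# * x · 1# + y · 1# * z · 1#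
    ·-homo-sum w x y z =
      trans (×-homo-+ 1# (w ℕ.* x) (y ℕ.* z)) (+-cong (×1-homo-* w x) (×1-homo-* y z))

  ≟-after-cancel : ∀ x y → Maybe.Maybe (⟦ x ⟧ℤ ≈ ⟦ y ⟧ℤ)
  ≟-after-cancel x y = Maybe.map equal (dec⇒maybe (≡-dec ℕ._≟_ ℕ._≟_ (cancel x) (cancel y)))
    where
    equal : cancel x ≡ cancel y → ⟦ x ⟧ℤ ≈ ⟦ y ⟧ℤ
    equal same = reflexive (≡.trans (≡.sym (⟦cancel⟧ x)) (≡.trans (≡.cong ⟦_⟧ℤ same) (⟦cancel⟧ y)))

  open import Algebra.Solver.Ring ℤ-rawRing (fromCommutativeRing R) embedding ≟-after-cancel
    public using (Polynomial; solve; _:=_; _:+_; _:*_; :-_; _:-_; con)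

  :1 :2 : ∀ {n} → Polynomial n
  :1 = con (1 , 0)
  :2 = con (2 , 0)

module _ {c ℓ} (S : Setoid c ℓ) where
  open Setoid S
  open import Relation.Binary.Reasoning.Setoid S

  enumeration⇒decidable : ∀ {n} (e : Fin n → Carrier) →
    (∀ i j → e i ≈ e j → i ≡ j) → (∀ x → ∃ λ i → e i ≈ x) → Decidable _≈_
  enumeration⇒decidable e injective surjective x y
    with surjective x | surjective y
  ... | i , eᵢ≈x | j , eⱼ≈y with i ≟ᶠ j
  ... | yes ≡.refl = yes (trans (sym eᵢ≈x) eⱼ≈y)
  ... | no i≢j     = no λ x≈y → i≢j (injective i j (trans eᵢ≈x (trans x≈y (sym eⱼ≈y))))

  ∃-avoiding : Decidable _≈_ → ∀ {m n} → m ℕ.< n → (e : Fin n → Carrier) →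
    (∀ i j → e i ≈ e j → i ≡ j) → (p : Fin m → Carrier) → ∃ λ i → ∀ j → ¬ e i ≈ p j
  ∃-avoiding _≟_ {m} m<n e injective p =
    decidable-stable (any? λ i → all? λ j → ¬? (e i ≟ p j)) not-all-covered
    where
    not-all-covered : ¬ ¬ ∃ λ i → ∀ j → ¬ e i ≈ p j
    not-all-covered none =
      let i , i′ , i<i′ , same = pigeonhole m<n (proj₁ ∘ hit)
      in <⇒≢ i<i′ (injective i i′ (begin
        e i                ≈⟨ proj₂ (hit i) ⟩
        p (proj₁ (hit i))  ≡⟨ ≡.cong p same ⟩
        p (proj₁ (hit i′)) ≈⟨ proj₂ (hit i′) ⟨
        e i′               ∎))
      where
      hit : ∀ i → ∃ λ j → e i ≈ p j
      hit i with j , ¬¬hit ← ¬∀⟶∃¬ m _ (λ j → ¬? (e i ≟ p j)) (λ avoids → none (i , avoids))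
        = j , decidable-stable (e i ≟ p j) ¬¬hit

module LineIdentities {c ℓ} (R : CommutativeRing c ℓ) where
  open CommutativeRing R
  open IntegerCoefficientSolver R
  open import Relation.Binary.Reasoning.Setoid setoid

  quadrance-between-lines : ∀ {a i t x₁ y₁ x₂ y₂} → y₁ ≈ a * x₁ + i → y₂ ≈ a * x₂ + i + t →
    Quadrance R (x₁ , y₁) (x₂ , y₂) ≈
      (x₂ - x₁) * (x₂ - x₁) + (a * (x₂ - x₁) + t) * (a * (x₂ - x₁) + t)
  quadrance-between-lines {a} {i} {t} {x₁} {y₁} {x₂} {y₂} y₁≈ y₂≈ =
    +-congˡ (*-cong y₂-y₁≈ y₂-y₁≈)
    where
    y₂-y₁≈ : y₂ - y₁ ≈ a * (x₂ - x₁) + t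
    y₂-y₁≈ = begin
      y₂ - y₁                           ≈⟨ +-cong y₂≈ (-‿cong y₁≈) ⟩
      (a * x₂ + i + t) - (a * x₁ + i)
        ≈⟨ solve 5 (λ a i t x₁ x₂ → (a :* x₂ :+ i :+ t) :- (a :* x₁ :+ i) := a :* (x₂ :- x₁) :+ t)
                   refl a i t x₁ x₂ ⟩
      a * (x₂ - x₁) + t                 ∎

  completing-the-square : ∀ a u t →
    ((a * a + 1#) * u + a * t) * ((a * a + 1#) * u + a * t) ≈
      (a * a + 1#) * (u * u + (a * u + t) * (a * u + t)) - t * t
  completing-the-square = solve 3 (λ a u t →
    ((a :* a :+ :1) :* u :+ a :* t) :* ((a :* a :+ :1) :* u :+ a :* t) :=
      (a :* a :+ :1) :* (u :* u :+ (a :* u :+ t) :* (a :* u :+ t)) :- t :* t) refl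

  rational-parametrisation : ∀ k l e →
    ((1# + 1#) * k * l * e) * ((1# + 1#) * k * l * e) +
      k * (((1# - k * (l * l)) * e) * ((1# - k * (l * l)) * e)) ≈
    k * (((1# + k * (l * l)) * e) * ((1# + k * (l * l)) * e))
  rational-parametrisation = solve 3 (λ k l e →
    (:2 :* k :* l :* e) :* (:2 :* k :* l :* e) :+
      k :* (((:1 :- k :* (l :* l)) :* e) :* ((:1 :- k :* (l :* l)) :* e)) :=
    k :* (((:1 :+ k :* (l :* l)) :* e) :* ((:1 :+ k :* (l :* l)) :* e))) refl

module _ {c ℓ} (R : CommutativeRing c ℓ) where
  open CommutativeRing R

  module DecidableField
    (0≉1 : ¬ 0# ≈ 1#)
    (inverse : ∀ x → ¬ x ≈ 0# → ∃ λ y → x * y ≈ 1#)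
    (_≟_ : Decidable _≈_)
    where
    open IntegerCoefficientSolver R
    open LineIdentities R
    open import Algebra.Properties.Group +-group using (∙-cancelˡ; x∙y⁻¹≈ε⇒x≈y; inverseˡ-unique)
    open import Relation.Binary.Reasoning.Setoid setoid

    1≉0 : ¬ 1# ≈ 0#
    1≉0 1≈0 = 0≉1 (sym 1≈0)

    y*[x*z]≈[x*y]*z : ∀ x y z → y * (x * z) ≈ (x * y) * z
    y*[x*z]≈[x*y]*z = solve 3 (λ x y z → y :* (x :* z) := (x :* y) :* z) refl

    *-cancelˡ : ∀ {x y z} → ¬ x ≈ 0# → x * y ≈ x * z → y ≈ z
    *-cancelˡ {x} {y} {z} x≉0 xy≈xz with x⁻¹ , xx⁻¹≈1 ← inverse x x≉0 = begin
      y              ≈⟨ *-identityˡ y ⟨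
      1# * y         ≈⟨ *-congʳ xx⁻¹≈1 ⟨
      (x * x⁻¹) * y  ≈⟨ y*[x*z]≈[x*y]*z x x⁻¹ y ⟨
      x⁻¹ * (x * y)  ≈⟨ *-congˡ xy≈xz ⟩
      x⁻¹ * (x * z)  ≈⟨ y*[x*z]≈[x*y]*z x x⁻¹ z ⟩
      (x * x⁻¹) * z  ≈⟨ *-congʳ xx⁻¹≈1 ⟩
      1# * z         ≈⟨ *-identityˡ z ⟩
      z              ∎

    x*y≈0⇒y≈0 : ∀ {x y} → ¬ x ≈ 0# → x * y ≈ 0# → y ≈ 0#
    x*y≈0⇒y≈0 {x} x≉0 xy≈0 = *-cancelˡ x≉0 (trans xy≈0 (sym (zeroʳ x)))

    x*y≉0 : ∀ {x y} → ¬ x ≈ 0# → ¬ y ≈ 0# → ¬ x * y ≈ 0#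
    x*y≉0 x≉0 y≉0 xy≈0 = y≉0 (x*y≈0⇒y≈0 x≉0 xy≈0)

    x*y≈0⇒x≈0⊎y≈0 : ∀ {x y} → x * y ≈ 0# → x ≈ 0# ⊎ y ≈ 0#
    x*y≈0⇒x≈0⊎y≈0 {x} xy≈0 with x ≟ 0#
    ... | yes x≈0 = inj₁ x≈0
    ... | no  x≉0 = inj₂ (x*y≈0⇒y≈0 x≉0 xy≈0)

    x*y≈1⇒y≉0 : ∀ {x y} → x * y ≈ 1# → ¬ y ≈ 0#
    x*y≈1⇒y≉0 {x} xy≈1 y≈0 = 0≉1 (trans (sym (trans (*-congˡ y≈0) (zeroʳ x))) xy≈1)

    x*x≈y*y⇒x≈±y : ∀ {x y} → x * x ≈ y * y → x ≈ y ⊎ x ≈ - y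
    x*x≈y*y⇒x≈±y {x} {y} xx≈yy =
      Sum.map (x∙y⁻¹≈ε⇒x≈y x y) (inverseˡ-unique x y) (x*y≈0⇒x≈0⊎y≈0 (begin
        (x - y) * (x + y) ≈⟨ solve 2 (λ x y → (x :- y) :* (x :+ y) := x :* x :- y :* y) refl x y ⟩
        x * x - y * y     ≈⟨ +-congʳ xx≈yy ⟩
        y * y - y * y     ≈⟨ -‿inverseʳ (y * y) ⟩
        0#                ∎))

    square-ratio : ∀ {w m k} → w * w ≈ k * (m * m) → ¬ m ≈ 0# → IsSquare R k
    square-ratio {w} {m} {k} ww≈kmm m≉0 with m⁻¹ , mm⁻¹≈1 ← inverse m m≉0 = w * m⁻¹ , (begin
      (w * m⁻¹) * (w * m⁻¹)          ≈⟨ solve 2 (λ w m⁻¹ →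
                                          (w :* m⁻¹) :* (w :* m⁻¹) := (w :* w) :* (m⁻¹ :* m⁻¹))
                                          refl w m⁻¹ ⟩
      (w * w) * (m⁻¹ * m⁻¹)          ≈⟨ *-congʳ ww≈kmm ⟩
      (k * (m * m)) * (m⁻¹ * m⁻¹)    ≈⟨ solve 3 (λ k m m⁻¹ →
                                          (k :* (m :* m)) :* (m⁻¹ :* m⁻¹) := k :* ((m :* m⁻¹) :* (m :* m⁻¹)))
                                          refl k m m⁻¹ ⟩
      k * ((m * m⁻¹) * (m * m⁻¹))    ≈⟨ *-congˡ (*-cong mm⁻¹≈1 mm⁻¹≈1) ⟩
      k * (1# * 1#)                  ≈⟨ *-congˡ (*-identityˡ 1#) ⟩
      k * 1#                         ≈⟨ *-identityʳ k ⟩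
      k                              ∎)

    module _ {a : Carrier} (a²+1-nonsquare : ¬ IsSquare R (a * a + 1#)) where

      k : Carrier
      k = a * a + 1#

      k≉0 : ¬ k ≈ 0#
      k≉0 k≈0 = a²+1-nonsquare (0# , trans (zeroʳ 0#) (sym k≈0))

      2≉0 : ¬ 1# + 1# ≈ 0#
      2≉0 2≈0 = a²+1-nonsquare (a + 1# , (begin
        (a + 1#) * (a + 1#)  ≈⟨ solve 1 (λ a → (a :+ :1) :* (a :+ :1) := a :* a :+ :1 :+ :2 :* a) refl a ⟩
        k + (1# + 1#) * a    ≈⟨ +-congˡ (trans (*-congʳ 2≈0) (zeroˡ a)) ⟩
        k + 0#               ≈⟨ +-identityʳ k ⟩
        k                    ∎))

      no-unit-quadrance : ∀ {t m} → t * t + k * (m * m) ≈ k → ¬ m ≈ 0# →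
        ∀ i x₁ y₁ x₂ y₂ → y₁ ≈ a * x₁ + i → y₂ ≈ a * x₂ + i + t →
        ¬ Quadrance R (x₁ , y₁) (x₂ , y₂) ≈ 1#
      no-unit-quadrance {t} {m} on-conic m≉0 i x₁ y₁ x₂ y₂ y₁≈ y₂≈ Q≈1 =
        a²+1-nonsquare (square-ratio ww≈kmm m≉0)
        where
        u = x₂ - x₁
        ww≈kmm : (k * u + a * t) * (k * u + a * t) ≈ k * (m * m)
        ww≈kmm = begin
          (k * u + a * t) * (k * u + a * t)          ≈⟨ completing-the-square a u t ⟩
          k * (u * u + (a * u + t) * (a * u + t)) - t * t
            ≈⟨ +-congʳ (*-congˡ (trans (sym (quadrance-between-lines y₁≈ y₂≈)) Q≈1)) ⟩
          k * 1# - t * t                             ≈⟨ +-congʳ (trans (*-identityʳ k) (sym on-conic)) ⟩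
          (t * t + k * (m * m)) - t * t
            ≈⟨ solve 2 (λ s n → (s :+ n) :- s := n) refl (t * t) (k * (m * m)) ⟩
          k * (m * m)                                ∎

      conic-point : ∀ {l} → ¬ l ≈ 0# → ¬ 1# + k * (l * l) ≈ 0# →
        ∃₂ λ t m → ¬ t ≈ 0# × ¬ m ≈ 0# × t * t + k * (m * m) ≈ k
      conic-point {l} l≉0 d≉0 with inverse (1# + k * (l * l)) d≉0
      ... | d⁻¹ , dd⁻¹≈1 = t , m , t≉0 , m≉0 , on-conic
        where
        t = (1# + 1#) * k * l * d⁻¹
        m = (1# - k * (l * l)) * d⁻¹

        d⁻¹≉0 : ¬ d⁻¹ ≈ 0#
        d⁻¹≉0 = x*y≈1⇒y≉0 dd⁻¹≈1

        t≉0 : ¬ t ≈ 0#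
        t≉0 = x*y≉0 (x*y≉0 (x*y≉0 2≉0 k≉0) l≉0) d⁻¹≉0

        1-kl²≉0 : ¬ 1# - k * (l * l) ≈ 0#
        1-kl²≉0 1-kl²≈0 = a²+1-nonsquare
          (square-ratio (trans (*-identityˡ 1#) (x∙y⁻¹≈ε⇒x≈y 1# _ 1-kl²≈0)) l≉0)

        m≉0 : ¬ m ≈ 0#
        m≉0 = x*y≉0 1-kl²≉0 d⁻¹≉0

        on-conic : t * t + k * (m * m) ≈ k
        on-conic = begin
          t * t + k * (m * m)                                         ≈⟨ rational-parametrisation k l d⁻¹ ⟩
          k * (((1# + k * (l * l)) * d⁻¹) * ((1# + k * (l * l)) * d⁻¹)) ≈⟨ *-congˡ (*-cong dd⁻¹≈1 dd⁻¹≈1) ⟩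
          k * (1# * 1#)                                               ≈⟨ *-congˡ (*-identityˡ 1#) ⟩
          k * 1#                                                      ≈⟨ *-identityʳ k ⟩
          k                                                           ∎

      -- The roots of 1 + kX² are ±ρ for any one root ρ, so l and 1 cannot both be roots.
      ∃-conic-point : ∀ {l} → ¬ l ≈ 0# → ¬ l ≈ 1# → ¬ l ≈ - 1# →
        ∃₂ λ t m → ¬ t ≈ 0# × ¬ m ≈ 0# × t * t + k * (m * m) ≈ k
      ∃-conic-point {l} l≉0 l≉1 l≉-1 with (1# + k * (1# * 1#)) ≟ 0#
      ... | no  1-not-root = conic-point 1≉0 1-not-root
      ... | yes 1-root     = conic-point l≉0 λ l-root → [ l≉1 , l≉-1 ]′
        (x*x≈y*y⇒x≈±y (*-cancelˡ k≉0 (∙-cancelˡ 1# _ _ (trans l-root (sym 1-root)))))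

lemma3 : ∀ {c ℓ : Level} (q : ℕ) (R : CommutativeRing c ℓ) →
    IsPrimePower q → ¬ (2 ∣ q) → 5 ≤ q → IsFiniteField R q →
    let open CommutativeRing R in
    (a : Carrier) → ¬ IsSquare R (a * a + 1#) →
    ∃ λ t → ¬ (t ≈ 0#) ×
      (∀ (i x₁ y₁ x₂ y₂ : Carrier) →
        y₁ ≈ a * x₁ + i → y₂ ≈ a * x₂ + i + t →
        ¬ (Quadrance R (x₁ , y₁) (x₂ , y₂) ≈ 1#))
lemma3 q R _ _ 5≤q F a a²+1-nonsquare =
  let l , l-avoids = ∃-avoiding setoid _≟_ (<⇒≤ 5≤q) enum enum-injective excluded
      t , m , t≉0 , m≉0 , on-conic = ∃-conic-point a²+1-nonsquare
        (l-avoids zero) (l-avoids (suc zero)) (l-avoids (suc (suc zero)))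
  in t , t≉0 , no-unit-quadrance a²+1-nonsquare on-conic m≉0
  where
  open CommutativeRing R hiding (zero)
  open IsFiniteField F

  _≟_ : Decidable _≈_
  _≟_ = enumeration⇒decidable setoid enum enum-injective enum-surjective

  open DecidableField R 0≉1 inverse _≟_

  excluded : Fin 3 → Carrier
  excluded = lookup (0# ∷ 1# ∷ - 1# ∷ [])
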